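{- There exist a graded Kleene algebra with tests $(K,T,+,;,{}^*,\rightarrow,0,1)$ and elements $b\in T$, $p\in K$ such that $b;p;(b\rightarrow0)+(b\rightarrow0);p;b=0$ but $b;p\neq p;b$.
   Context: A graded Kleene algebra with tests (GKAT) is a tuple $(K,T,+,;,{}^*,\rightarrow,0,1)$ where $K$ is a set, $T\subseteq K$, $0,1\in T$, $+$ and $;$ are binary operations on $K$ under which $T$ is closed, ${}^*$ is unary on $K$, and $\rightarrow$ is a binary operation on $T$ with values in $T$, such that for all $p,q,r\in K$ and $a,b,c\in T$: $p+(q+r)=(p+q)+r$; $p+q=q+p$; $p;(q;r)=(p;q);r$; $p;1=1;p=p$; $p;(q+r)=p;q+p;r$; $(p+q);r=p;r+q;r$; $p;0=0;p=0$; $1+p;p^*=p^*$; $q+p;r\leq r\Rightarrow p^*;q\leq r$; $q+r;p\leq r\Rightarrow q;p^*\leq r$; $a;b\leq c\Leftrightarrow b\leq a\rightarrow c$; $a\leq 1$; $a;b=b;a$, where $p\leq q$ means $p+q=q$. -}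

module Defs where

open import Data.Product using (Σ; _,_; proj₁)
open import Relation.Binary.PropositionalEquality using (_≡_)

record GKAT : Set₁ where
  infixl 6 _+_
  infixl 7 _⨟_
  infix  4 _≤_
  field
    K    : Set
    Test : K → Set
    _+_  : K → K → K
    _⨟_  : K → K → K
    _⋆   : K → K
    𝟘    : K
    𝟙    : K
    𝟘∈T  : Test 𝟘
    𝟙∈T  : Test 𝟙
    +-closed : ∀ {a b} → Test a → Test b → Test (a + b)
    ⨟-closed : ∀ {a b} → Test a → Test b → Test (a ⨟ b)

  T : Set
  T = Σ K Test

  _≤_ : K → K → Set
  p ≤ q = p + q ≡ q

  field
    _⇒_  : T → T → T

    +-assoc  : ∀ p q r → p + (q + r) ≡ (p + q) + r
    +-comm   : ∀ p q → p + q ≡ q + p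
    ⨟-assoc  : ∀ p q r → p ⨟ (q ⨟ r) ≡ (p ⨟ q) ⨟ r
    ⨟-identityʳ : ∀ p → p ⨟ 𝟙 ≡ p
    ⨟-identityˡ : ∀ p → 𝟙 ⨟ p ≡ p
    distribˡ : ∀ p q r → p ⨟ (q + r) ≡ p ⨟ q + p ⨟ r
    distribʳ : ∀ p q r → (p + q) ⨟ r ≡ p ⨟ r + q ⨟ r
    zeroʳ    : ∀ p → p ⨟ 𝟘 ≡ 𝟘
    zeroˡ    : ∀ p → 𝟘 ⨟ p ≡ 𝟘
    star-unfold : ∀ p → 𝟙 + p ⨟ (p ⋆) ≡ p ⋆
    star-indˡ   : ∀ p q r → q + p ⨟ r ≤ r → (p ⋆) ⨟ q ≤ r
    star-indʳ   : ∀ p q r → q + r ⨟ p ≤ r → q ⨟ (p ⋆) ≤ r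
    residuation-⇒ : ∀ (a b c : T) → proj₁ a ⨟ proj₁ b ≤ proj₁ c
                    → proj₁ b ≤ proj₁ (a ⇒ c)
    residuation-⇐ : ∀ (a b c : T) → proj₁ b ≤ proj₁ (a ⇒ c)
                    → proj₁ a ⨟ proj₁ b ≤ proj₁ c
    test-≤𝟙  : ∀ (a : T) → proj₁ a ≤ 𝟙
    test-comm : ∀ (a b : T) → proj₁ a ⨟ proj₁ b ≡ proj₁ b ⨟ proj₁ a

  𝟘ᵀ : T
  𝟘ᵀ = 𝟘 , 𝟘∈T

-- The tests of a GKAT only have to form a Heyting algebra, so b → 0 need not
-- be a complement of b.  Take K to be the upper triangular 2 × 2 Boolean
-- matrices and T the three-element chain 0 < e < 1, where e = diag(1, 0).
-- Then e → 0 = 0, so both terms of  b ; p ; (b → 0) + (b → 0) ; p ; b  vanish,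
-- while e does not commute with the nilpotent matrix n with a single 1 in the
-- corner: e ; n = n but n ; e = 0.  All GKAT laws hold in this eight-element
-- algebra, which is checked by exhaustion.
module Submission where

open import Defs
open import Data.Bool using (Bool; true; false; _∧_; _∨_; if_then_else_; f≤t; b≤b)
  renaming (_≤_ to _≤ᵇ_)
import Data.Bool.Properties as Bool
open import Data.Product using (Σ; _,_; proj₁; _×_)
open import Data.Unit using (tt)
open import Relation.Binary.Definitions using (DecidableEquality)
open import Relation.Binary.PropositionalEquality using (_≡_; _≢_; refl)
open import Relation.Nullary.Decidable
  using (Dec; yes; no; does; map′; _×-dec_; _→-dec_; toWitness)
open import Relation.Unary using (Decidable)

∀-Bool? : {P : Bool → Set} → Decidable P → Dec (∀ b → P b)
∀-Bool? P? with P? false | P? true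
... | yes p-false | yes p-true = yes λ { false → p-false ; true → p-true }
... | no ¬p-false | _          = no λ p → ¬p-false (p false)
... | yes _       | no ¬p-true = no λ p → ¬p-true (p true)

-- tri a c d is the matrix [[a, c], [0, d]].
record Tri : Set where
  constructor tri
  field
    top corner bottom : Bool

∀? : {P : Tri → Set} → Decidable P → Dec (∀ x → P x)
∀? P? = map′ (λ p → λ { (tri a c d) → p a c d }) (λ p a c d → p (tri a c d))
  (∀-Bool? λ a → ∀-Bool? λ c → ∀-Bool? λ d → P? (tri a c d))

_≟_ : DecidableEquality Tri
tri a c d ≟ tri a′ c′ d′ =
  map′ (λ { (refl , refl , refl) → refl }) (λ { refl → refl , refl , refl })
    (a Bool.≟ a′ ×-dec c Bool.≟ c′ ×-dec d Bool.≟ d′)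

infixl 6 _⊕_
infixl 7 _⊗_
infix  4 _⊑_ _≟_
infixr 5 _⇨_

_⊕_ : Tri → Tri → Tri
tri a c d ⊕ tri a′ c′ d′ = tri (a ∨ a′) (c ∨ c′) (d ∨ d′)

_⊗_ : Tri → Tri → Tri
tri a c d ⊗ tri a′ c′ d′ = tri (a ∧ a′) (a ∧ c′ ∨ c ∧ d′) (d ∧ d′)

-- The star [[a*, a* c d*], [0, d*]] of a triangular matrix, with a* = d* = 1.
_✱ : Tri → Tri
tri a c d ✱ = tri true c true

𝟎 𝟏 : Tri
𝟎 = tri false false false
𝟏 = tri true false true

_⊑_ : Tri → Tri → Set
x ⊑ y = x ⊕ y ≡ y

-- Excluding diag(0, 1) makes the tests a chain rather than a Boolean algebra.
data IsTest : Tri → Set where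
  diag : ∀ {a d} → d ≤ᵇ a → IsTest (tri a false d)

isTest? : Decidable IsTest
isTest? (tri a true  d) = no λ ()
isTest? (tri a false d) = map′ diag (λ { (diag d≤a) → d≤a }) (d Bool.≤? a)

-- Gödel implication on the chain of tests.
_⇨_ : Tri → Tri → Tri
a ⇨ c = if does (a ⊕ c ≟ c) then 𝟏 else c

⊕-assoc : ∀ p q r → p ⊕ (q ⊕ r) ≡ (p ⊕ q) ⊕ r
⊕-assoc = toWitness {a? = ∀? λ p → ∀? λ q → ∀? λ r → _ ≟ _} tt

⊕-comm : ∀ p q → p ⊕ q ≡ q ⊕ p
⊕-comm = toWitness {a? = ∀? λ p → ∀? λ q → _ ≟ _} tt

⊗-assoc : ∀ p q r → p ⊗ (q ⊗ r) ≡ (p ⊗ q) ⊗ r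
⊗-assoc = toWitness {a? = ∀? λ p → ∀? λ q → ∀? λ r → _ ≟ _} tt

⊗-identityˡ : ∀ p → 𝟏 ⊗ p ≡ p
⊗-identityˡ = toWitness {a? = ∀? λ p → _ ≟ _} tt

⊗-identityʳ : ∀ p → p ⊗ 𝟏 ≡ p
⊗-identityʳ = toWitness {a? = ∀? λ p → _ ≟ _} tt

⊗-distribˡ-⊕ : ∀ p q r → p ⊗ (q ⊕ r) ≡ p ⊗ q ⊕ p ⊗ r
⊗-distribˡ-⊕ = toWitness {a? = ∀? λ p → ∀? λ q → ∀? λ r → _ ≟ _} tt

⊗-distribʳ-⊕ : ∀ p q r → (p ⊕ q) ⊗ r ≡ p ⊗ r ⊕ q ⊗ r
⊗-distribʳ-⊕ = toWitness {a? = ∀? λ p → ∀? λ q → ∀? λ r → _ ≟ _} tt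

⊗-zeroˡ : ∀ p → 𝟎 ⊗ p ≡ 𝟎
⊗-zeroˡ = toWitness {a? = ∀? λ p → _ ≟ _} tt

⊗-zeroʳ : ∀ p → p ⊗ 𝟎 ≡ 𝟎
⊗-zeroʳ = toWitness {a? = ∀? λ p → _ ≟ _} tt

✱-unfold : ∀ p → 𝟏 ⊕ p ⊗ p ✱ ≡ p ✱
✱-unfold = toWitness {a? = ∀? λ p → _ ≟ _} tt

✱-inductionˡ : ∀ p q r → q ⊕ p ⊗ r ⊑ r → p ✱ ⊗ q ⊑ r
✱-inductionˡ = toWitness {a? = ∀? λ p → ∀? λ q → ∀? λ r → _ ≟ _ →-dec _ ≟ _} tt

✱-inductionʳ : ∀ p q r → q ⊕ r ⊗ p ⊑ r → q ⊗ p ✱ ⊑ r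
✱-inductionʳ = toWitness {a? = ∀? λ p → ∀? λ q → ∀? λ r → _ ≟ _ →-dec _ ≟ _} tt

⊕-preserves-test : ∀ a b → IsTest a → IsTest b → IsTest (a ⊕ b)
⊕-preserves-test = toWitness {a? = ∀? λ a → ∀? λ b →
  isTest? a →-dec isTest? b →-dec isTest? (a ⊕ b)} tt

⊗-preserves-test : ∀ a b → IsTest a → IsTest b → IsTest (a ⊗ b)
⊗-preserves-test = toWitness {a? = ∀? λ a → ∀? λ b →
  isTest? a →-dec isTest? b →-dec isTest? (a ⊗ b)} tt

⇨-preserves-test : ∀ a b → IsTest a → IsTest b → IsTest (a ⇨ b)
⇨-preserves-test = toWitness {a? = ∀? λ a → ∀? λ b →
  isTest? a →-dec isTest? b →-dec isTest? (a ⇨ b)} tt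

⇨-residualʳ : ∀ a b c → IsTest a → IsTest b → IsTest c → a ⊗ b ⊑ c → b ⊑ a ⇨ c
⇨-residualʳ = toWitness {a? = ∀? λ a → ∀? λ b → ∀? λ c →
  isTest? a →-dec isTest? b →-dec isTest? c →-dec _ ≟ _ →-dec _ ≟ _} tt

⇨-residualˡ : ∀ a b c → IsTest a → IsTest c → b ⊑ a ⇨ c → a ⊗ b ⊑ c
⇨-residualˡ = toWitness {a? = ∀? λ a → ∀? λ b → ∀? λ c →
  isTest? a →-dec isTest? c →-dec _ ≟ _ →-dec _ ≟ _} tt

test⊑𝟏 : ∀ a → IsTest a → a ⊑ 𝟏
test⊑𝟏 = toWitness {a? = ∀? λ a → isTest? a →-dec _ ≟ _} tt

tests-commute : ∀ a b → IsTest a → IsTest b → a ⊗ b ≡ b ⊗ a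
tests-commute = toWitness {a? = ∀? λ a → ∀? λ b →
  isTest? a →-dec isTest? b →-dec _ ≟ _} tt

triangularGKAT : GKAT
triangularGKAT = record
  { K = Tri
  ; Test = IsTest
  ; _+_ = _⊕_
  ; _⨟_ = _⊗_
  ; _⋆ = _✱
  ; 𝟘 = 𝟎
  ; 𝟙 = 𝟏
  ; 𝟘∈T = diag b≤b
  ; 𝟙∈T = diag b≤b
  ; +-closed = ⊕-preserves-test _ _
  ; ⨟-closed = ⊗-preserves-test _ _
  ; _⇒_ = λ (a , a∈T) (c , c∈T) → a ⇨ c , ⇨-preserves-test a c a∈T c∈T
  ; +-assoc = ⊕-assoc
  ; +-comm = ⊕-comm
  ; ⨟-assoc = ⊗-assoc
  ; ⨟-identityʳ = ⊗-identityʳ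
  ; ⨟-identityˡ = ⊗-identityˡ
  ; distribˡ = ⊗-distribˡ-⊕
  ; distribʳ = ⊗-distribʳ-⊕
  ; zeroʳ = ⊗-zeroʳ
  ; zeroˡ = ⊗-zeroˡ
  ; star-unfold = ✱-unfold
  ; star-indˡ = ✱-inductionˡ
  ; star-indʳ = ✱-inductionʳ
  ; residuation-⇒ = λ (a , a∈T) (b , b∈T) (c , c∈T) → ⇨-residualʳ a b c a∈T b∈T c∈T
  ; residuation-⇐ = λ (a , a∈T) (b , _) (c , c∈T) → ⇨-residualˡ a b c a∈T c∈T
  ; test-≤𝟙 = λ (a , a∈T) → test⊑𝟏 a a∈T
  ; test-comm = λ (a , a∈T) (b , b∈T) → tests-commute a b a∈T b∈T
  }

e n : Tri
e = tri true false false
n = tri false true false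

lemma6 : Σ GKAT λ G → let open GKAT G in
    Σ T λ b → Σ K λ p →
    ((proj₁ b ⨟ p ⨟ proj₁ (b ⇒ 𝟘ᵀ)) + (proj₁ (b ⇒ 𝟘ᵀ) ⨟ p ⨟ proj₁ b) ≡ 𝟘)
    × (proj₁ b ⨟ p ≢ p ⨟ proj₁ b)
lemma6 = triangularGKAT , (e , diag f≤t) , n , refl , λ ()
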